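{- Let $f \colon X \to Y$ and $g \colon Y \to X$ be maps between orthosets such that $g$ is an adjoint of $f$. Then the following are equivalent: (a) $f$ is an orthometry and $g$ is a generalised inverse of $f$. (b) $g$ is a coorthometry and $f$ is a generalised inverse of $g$. (c) $\operatorname{im} f = (\ker g)^\perp$, and $f$ with codomain restricted to $\operatorname{im} f$ is an orthoisomorphism between $X$ and the subspace $\operatorname{im} f$ of $Y$, whose inverse is the restriction of $g$ to $\operatorname{im} f$. (d) $\operatorname{im} f$ is orthoclosed and $g \circ f = \mathrm{id}_X$. In this case, the zero-kernel restriction of $f$ is $f$ with codomain restricted to $\operatorname{im} f$, and the zero-kernel restriction of $g$ is the restriction of $g$ to $\operatorname{im} f$.
   Context: An orthoset (with $0$) is a non-empty set $X$ with a binary relation $\perp$ and element $0$ such that: $\perp$ is symmetric; $x\perp x$ iff $x=0$; $0\perp x$ for all $x$. For $A\subseteq X$, $A^\perp=\{x:x\perp y\ \forall y\in A\}$; $A$ is orthoclosed (a subspace) if $A=A^{\perp\perp}$; subspaces are orthosets with the restricted relation. $g\colon Y\to X$ is an adjoint of $f\colon X\to Y$ if $f(x)\perp y\iff x\perp g(y)$ for all $x,y$. $\ker f=\{x:f(x)=0\}$, $\operatorname{im} f=f(X)$. An orthoisomorphism is a bijection $h$ with $h(0)=0$ and $x\perp y\iff h(x)\perp h(y)$. For adjointable $f$, the zero-kernel restriction of $f$ is the map $(\ker f)^\perp\to(\operatorname{im} f)^{\perp\perp}$, $x\mapsto f(x)$. A map $f$ is a partial orthometry if it has an adjoint $g$ (a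 generalised inverse of $f$) such that there are subspaces $A$ of $X$, $B$ of $Y$ with $A^\perp=\ker f$, $B^\perp=\ker g$, and $f,g$ restrict to mutually inverse orthoisomorphisms between $A$ and $B$. An orthometry is an injective partial orthometry; a coorthometry is a surjective partial orthometry. -}

module Defs where

open import Level using (Level; _⊔_) renaming (suc to lsuc)
open import Data.Product using (Σ; ∃; _×_; _,_)
open import Function.Bundles using (_⇔_)
open import Relation.Unary using (Pred; _∈_; _⊆_; _≐_; U)
open import Relation.Binary.PropositionalEquality using (_≡_)

record Orthoset (a : Level) : Set (lsuc a) where
  field
    Carrier : Set a
    _⊥_     : Carrier → Carrier → Set a
    𝟎       : Carrier
    ⊥-sym   : ∀ {x y} → x ⊥ y → y ⊥ x
    ⊥-self  : ∀ {x} → x ⊥ x → x ≡ 𝟎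
    𝟎-⊥     : ∀ x → 𝟎 ⊥ x

open Orthoset public

module _ {a : Level} (X : Orthoset a) where

  _ᗮ : {ℓ : Level} → Pred (Carrier X) ℓ → Pred (Carrier X) (a ⊔ ℓ)
  _ᗮ A x = ∀ y → y ∈ A → _⊥_ X x y

  Orthoclosed : {ℓ : Level} → Pred (Carrier X) ℓ → Set (a ⊔ ℓ)
  Orthoclosed A = A ≐ ((A ᗮ) ᗮ)

module _ {a b : Level} {X : Orthoset a} {Y : Orthoset b} where

  record IsOrthoIsoOn {p q : Level} (A : Pred (Carrier X) p) (B : Pred (Carrier Y) q)
                      (h : Carrier X → Carrier Y) (k : Carrier Y → Carrier X)
                      : Set (a ⊔ b ⊔ p ⊔ q) where
    field
      maps-into : ∀ x → x ∈ A → h x ∈ B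
      inv-into  : ∀ y → y ∈ B → k y ∈ A
      inv-left  : ∀ x → x ∈ A → k (h x) ≡ x
      inv-right : ∀ y → y ∈ B → h (k y) ≡ y
      pres-𝟎    : h (𝟎 X) ≡ 𝟎 Y
      pres-⊥    : ∀ x x′ → x ∈ A → x′ ∈ A → (_⊥_ X x x′) ⇔ (_⊥_ Y (h x) (h x′))

module _ {a b : Level} {X : Orthoset a} {Y : Orthoset b} where

  ker : (Carrier X → Carrier Y) → Pred (Carrier X) b
  ker f x = f x ≡ 𝟎 Y

  im : (Carrier X → Carrier Y) → Pred (Carrier Y) (a ⊔ b)
  im f y = ∃ λ x → f x ≡ y

  IsAdjoint : (Carrier X → Carrier Y) → (Carrier Y → Carrier X) → Set (a ⊔ b)
  IsAdjoint f g = ∀ x y → (_⊥_ Y (f x) y) ⇔ (_⊥_ X x (g y))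

module _ {a b : Level} {X : Orthoset a} {Y : Orthoset b} where

  IsGeneralisedInverse : (Carrier X → Carrier Y) → (Carrier Y → Carrier X) → Set (lsuc (a ⊔ b))
  IsGeneralisedInverse f g =
    IsAdjoint {X = X} {Y = Y} f g ×
    Σ (Pred (Carrier X) a) λ A → Σ (Pred (Carrier Y) b) λ B →
      Orthoclosed X A × Orthoclosed Y B ×
      ((X ᗮ) A ≐ ker {X = X} {Y = Y} f) × ((Y ᗮ) B ≐ ker {X = Y} {Y = X} g) ×
      IsOrthoIsoOn {X = X} {Y = Y} A B f g × IsOrthoIsoOn {X = Y} {Y = X} B A g f

  IsPartialOrthometry : (Carrier X → Carrier Y) → Set (lsuc (a ⊔ b))
  IsPartialOrthometry f = Σ (Carrier Y → Carrier X) λ g → IsGeneralisedInverse f g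

  Injective : (Carrier X → Carrier Y) → Set (a ⊔ b)
  Injective f = ∀ x x′ → f x ≡ f x′ → x ≡ x′

  Surjective : (Carrier X → Carrier Y) → Set (a ⊔ b)
  Surjective f = ∀ y → ∃ λ x → f x ≡ y

  IsOrthometry : (Carrier X → Carrier Y) → Set (lsuc (a ⊔ b))
  IsOrthometry f = Injective f × IsPartialOrthometry f

  IsCoorthometry : (Carrier X → Carrier Y) → Set (lsuc (a ⊔ b))
  IsCoorthometry f = Surjective f × IsPartialOrthometry f

-- Condition (d) is the pivot.  If g ∘ f = id then ker f = {0}, im f is the set
-- of fixed points of f ∘ g, and adjointness alone makes f and g mutually inverse
-- orthoisomorphisms between Fix (g ∘ f) = X and Fix (f ∘ g) = im f; since
-- ker g = (im f)ᗮ, orthoclosedness of im f gives the kernel conditions of a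
-- generalised inverse.  Conversely, for a generalised inverse the subspace A has
-- A ᗮ = ker f, so whenever ker f = {0} (f injective, or g surjective) A is all of
-- X, g ∘ f = id, and im f is the subspace B.
module Submission where

open import Defs
open import Level using (Level; _⊔_)
open import Data.Product using (_×_; _,_; proj₁; proj₂)
open import Data.Unit using (tt)
open import Function.Base using (_∘_)
open import Function.Bundles using (_⇔_; mk⇔; Equivalence)
open import Relation.Unary using (Pred; U; _⊆_; _≐_; _∈_)
open import Relation.Unary.Properties using (≐-sym; ≐-trans)
open import Relation.Binary.PropositionalEquality using (_≡_; refl; sym; trans; cong; subst)

open Equivalence

Fix : ∀ {a} {A : Set a} → (A → A) → Pred A a
Fix h x = h x ≡ x

module _ {a : Level} (X : Orthoset a) where

  ⊥-𝟎 : ∀ x → _⊥_ X x (𝟎 X)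
  ⊥-𝟎 x = ⊥-sym X (𝟎-⊥ X x)

  ⊆-ᗮᗮ : ∀ {ℓ} (A : Pred (Carrier X) ℓ) → A ⊆ (X ᗮ) ((X ᗮ) A)
  ⊆-ᗮᗮ A x∈A y y∈Aᗮ = ⊥-sym X (y∈Aᗮ _ x∈A)

  ᗮ-antitone : ∀ {ℓ ℓ′} {A : Pred (Carrier X) ℓ} {B : Pred (Carrier X) ℓ′} →
               A ⊆ B → (X ᗮ) B ⊆ (X ᗮ) A
  ᗮ-antitone A⊆B x∈Bᗮ y y∈A = x∈Bᗮ y (A⊆B y∈A)

  ᗮ-cong : ∀ {ℓ ℓ′} {A : Pred (Carrier X) ℓ} {B : Pred (Carrier X) ℓ′} →
           A ≐ B → (X ᗮ) A ≐ (X ᗮ) B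
  ᗮ-cong (A⊆B , B⊆A) = ᗮ-antitone B⊆A , ᗮ-antitone A⊆B

  Orthoclosed-cong : ∀ {ℓ ℓ′} {A : Pred (Carrier X) ℓ} {B : Pred (Carrier X) ℓ′} →
                     A ≐ B → Orthoclosed X A → Orthoclosed X B
  Orthoclosed-cong A≐B A-closed =
    ≐-trans (≐-sym A≐B) (≐-trans A-closed (ᗮ-cong (ᗮ-cong A≐B)))

  Orthoclosed-full : ∀ {ℓ} {A : Pred (Carrier X) ℓ} → (∀ x → x ∈ A) → Orthoclosed X A
  Orthoclosed-full {A = A} full = ⊆-ᗮᗮ A , λ {x} _ → full x

  ᗮ-of-⊆𝟎 : ∀ {ℓ} {A : Pred (Carrier X) ℓ} → A ⊆ (_≡ 𝟎 X) → (X ᗮ) A ≐ U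
  ᗮ-of-⊆𝟎 A⊆𝟎 = (λ _ → tt) , λ {x} _ y y∈A → subst (_⊥_ X x) (sym (A⊆𝟎 y∈A)) (⊥-𝟎 x)

  ᗮ-of-full : ∀ {ℓ} {A : Pred (Carrier X) ℓ} → (∀ x → x ∈ A) → (X ᗮ) A ≐ (_≡ 𝟎 X)
  ᗮ-of-full full = (λ {x} x∈Aᗮ → ⊥-self X (x∈Aᗮ x (full x)))
                 , λ { refl y _ → 𝟎-⊥ X y }

module Adjunction {a b : Level} {X : Orthoset a} {Y : Orthoset b}
    {f : Carrier X → Carrier Y} {g : Carrier Y → Carrier X}
    (adj : IsAdjoint {X = X} {Y = Y} f g) where

  adjoint-sym : IsAdjoint {X = Y} {Y = X} g f
  adjoint-sym y x = mk⇔ (λ p → ⊥-sym Y (from (adj x y) (⊥-sym X p)))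
                        (λ p → ⊥-sym X (to (adj x y) (⊥-sym Y p)))

  f𝟎≡𝟎 : f (𝟎 X) ≡ 𝟎 Y
  f𝟎≡𝟎 = ⊥-self Y (from (adj (𝟎 X) (f (𝟎 X))) (𝟎-⊥ X _))

  ker≐ᗮim : ker {X = Y} {Y = X} g ≐ (Y ᗮ) (im {X = X} {Y = Y} f)
  ker≐ᗮim = (λ { {y} gy≡𝟎 _ (x , refl) →
                   ⊥-sym Y (from (adj x y) (subst (_⊥_ X x) (sym gy≡𝟎) (⊥-𝟎 X x))) })
          , λ {y} y∈imᗮ → ⊥-self X (to (adj (g y) y) (⊥-sym Y (y∈imᗮ _ (g y , refl))))

  ker∩im⊆𝟎 : ∀ y → f (g y) ≡ 𝟎 Y → g y ≡ 𝟎 X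
  ker∩im⊆𝟎 y fgy≡𝟎 = ⊥-self X (to (adj (g y) y) (subst (λ z → _⊥_ Y z y) (sym fgy≡𝟎) (𝟎-⊥ Y y)))

  injective-ker⊆𝟎 : Injective {X = X} {Y = Y} f → ker {X = X} {Y = Y} f ⊆ (_≡ 𝟎 X)
  injective-ker⊆𝟎 inj {x} fx≡𝟎 = inj x (𝟎 X) (trans fx≡𝟎 (sym f𝟎≡𝟎))

  surjective-ker⊆𝟎 : Surjective {X = Y} {Y = X} g → ker {X = X} {Y = Y} f ⊆ (_≡ 𝟎 X)
  surjective-ker⊆𝟎 surj {x} fx≡𝟎 with surj x
  ... | y , refl = ker∩im⊆𝟎 y fx≡𝟎

  fixedPoints-orthoIso : IsOrthoIsoOn {X = X} {Y = Y} (Fix (g ∘ f)) (Fix (f ∘ g)) f g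
  fixedPoints-orthoIso = record
    { maps-into = λ _ gfx≡x → cong f gfx≡x
    ; inv-into  = λ _ fgy≡y → cong g fgy≡y
    ; inv-left  = λ _ gfx≡x → gfx≡x
    ; inv-right = λ _ fgy≡y → fgy≡y
    ; pres-𝟎    = f𝟎≡𝟎
    ; pres-⊥    = λ x x′ _ gfx′≡x′ →
        mk⇔ (λ x⊥x′ → from (adj x (f x′)) (subst (_⊥_ X x) (sym gfx′≡x′) x⊥x′))
            (λ fx⊥fx′ → subst (_⊥_ X x) gfx′≡x′ (to (adj x (f x′)) fx⊥fx′))
    }

module _ {a b : Level} {X : Orthoset a} {Y : Orthoset b}
         {h : Carrier X → Carrier Y} {k : Carrier Y → Carrier X} where

  open IsOrthoIsoOn

  IsOrthoIsoOn-cong : ∀ {p p′ q q′} {A : Pred (Carrier X) p} {A′ : Pred (Carrier X) p′}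
                      {B : Pred (Carrier Y) q} {B′ : Pred (Carrier Y) q′} →
                      A ≐ A′ → B ≐ B′ →
                      IsOrthoIsoOn {X = X} {Y = Y} A B h k → IsOrthoIsoOn {X = X} {Y = Y} A′ B′ h k
  IsOrthoIsoOn-cong (A⊆A′ , A′⊆A) (B⊆B′ , B′⊆B) iso = record
    { maps-into = λ x x∈A′ → B⊆B′ (maps-into iso x (A′⊆A x∈A′))
    ; inv-into  = λ y y∈B′ → A⊆A′ (inv-into iso y (B′⊆B y∈B′))
    ; inv-left  = λ x x∈A′ → inv-left iso x (A′⊆A x∈A′)
    ; inv-right = λ y y∈B′ → inv-right iso y (B′⊆B y∈B′)
    ; pres-𝟎    = pres-𝟎 iso
    ; pres-⊥    = λ x x′ x∈A′ x′∈A′ → pres-⊥ iso x x′ (A′⊆A x∈A′) (A′⊆A x′∈A′)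
    }

  IsOrthoIsoOn-onto-im : ∀ {p q} {A : Pred (Carrier X) p} {B : Pred (Carrier Y) q} →
                         (∀ x → x ∈ A) → IsOrthoIsoOn {X = X} {Y = Y} A B h k →
                         B ≐ im {X = X} {Y = Y} h
  IsOrthoIsoOn-onto-im full iso = (λ {y} y∈B → k y , inv-right iso y y∈B)
                                , λ { (x , refl) → maps-into iso x (full x) }

  IsGeneralisedInverse-sym : IsGeneralisedInverse {X = X} {Y = Y} h k →
                             IsGeneralisedInverse {X = Y} {Y = X} k h
  IsGeneralisedInverse-sym (adj , A , B , A-closed , B-closed , Aᗮ≐ker , Bᗮ≐ker , iso , iso⁻¹) =
    Adjunction.adjoint-sym {X = X} {Y = Y} adj , B , A , B-closed , A-closed , Bᗮ≐ker , Aᗮ≐ker , iso⁻¹ , iso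

module OrthoclosedSection {a b : Level} {X : Orthoset a} {Y : Orthoset b}
    {f : Carrier X → Carrier Y} {g : Carrier Y → Carrier X}
    (adj : IsAdjoint {X = X} {Y = Y} f g) where

  open Adjunction {X = X} {Y = Y} {f} {g} adj
  module Adjunctionᵀ = Adjunction {X = Y} {Y = X} {g} {f} adjoint-sym

  IsOrthoclosedSection : Set (a ⊔ b)
  IsOrthoclosedSection = Orthoclosed Y (im {X = X} {Y = Y} f) × (∀ x → g (f x) ≡ x)

  module _ (gf≡id : ∀ x → g (f x) ≡ x) where

    ker≐𝟎 : ker {X = X} {Y = Y} f ≐ (_≡ 𝟎 X)
    ker≐𝟎 = (λ {x} fx≡𝟎 → trans (sym (gf≡id x)) (trans (cong g fx≡𝟎) Adjunctionᵀ.f𝟎≡𝟎))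
          , λ { refl → f𝟎≡𝟎 }

    im≐Fix : im {X = X} {Y = Y} f ≐ Fix (f ∘ g)
    im≐Fix = (λ { (x , refl) → cong f (gf≡id x) }) , λ {y} fgy≡y → g y , fgy≡y

  ᗮker≐ᗮᗮim : (Y ᗮ) (ker {X = Y} {Y = X} g) ≐ (Y ᗮ) ((Y ᗮ) (im {X = X} {Y = Y} f))
  ᗮker≐ᗮᗮim = ᗮ-cong Y ker≐ᗮim

  section⇒generalisedInverse : IsOrthoclosedSection → IsGeneralisedInverse {X = X} {Y = Y} f g
  section⇒generalisedInverse (im-closed , gf≡id) =
    adj , Fix (g ∘ f) , Fix (f ∘ g)
    , Orthoclosed-full X gf≡id
    , Orthoclosed-cong Y (im≐Fix gf≡id) im-closed
    , ≐-trans (ᗮ-of-full X gf≡id) (≐-sym (ker≐𝟎 gf≡id))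
    , ≐-trans (ᗮ-cong Y (≐-sym (im≐Fix gf≡id))) (≐-sym ker≐ᗮim)
    , fixedPoints-orthoIso , Adjunctionᵀ.fixedPoints-orthoIso

  generalisedInverse⇒section : IsGeneralisedInverse {X = X} {Y = Y} f g →
                               ker {X = X} {Y = Y} f ⊆ (_≡ 𝟎 X) → IsOrthoclosedSection
  generalisedInverse⇒section (_ , A , B , A-closed , B-closed , Aᗮ≐ker , _ , iso , _) ker⊆𝟎 =
    Orthoclosed-cong Y (IsOrthoIsoOn-onto-im A-full iso) B-closed
    , λ x → IsOrthoIsoOn.inv-left iso x (A-full x)
    where
    A-full : ∀ x → x ∈ A
    A-full x = proj₂ A-closed (proj₂ (ᗮ-of-⊆𝟎 X (λ x∈Aᗮ → ker⊆𝟎 (proj₁ Aᗮ≐ker x∈Aᗮ))) tt)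

  section⇔orthometry : IsOrthoclosedSection ⇔
    (IsOrthometry {X = X} {Y = Y} f × IsGeneralisedInverse {X = X} {Y = Y} f g)
  section⇔orthometry = mk⇔
    (λ s → let gi = section⇒generalisedInverse s in (injective s , g , gi) , gi)
    (λ { ((inj , _) , gi) → generalisedInverse⇒section gi (injective-ker⊆𝟎 inj) })
    where
    injective : IsOrthoclosedSection → Injective {X = X} {Y = Y} f
    injective (_ , gf≡id) x x′ fx≡fx′ = trans (sym (gf≡id x)) (trans (cong g fx≡fx′) (gf≡id x′))

  section⇔coorthometry : IsOrthoclosedSection ⇔
    (IsCoorthometry {X = Y} {Y = X} g × IsGeneralisedInverse {X = Y} {Y = X} g f)
  section⇔coorthometry = mk⇔
    (λ s → let gi = IsGeneralisedInverse-sym (section⇒generalisedInverse s)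
           in ((λ x → f x , proj₂ s x) , f , gi) , gi)
    (λ { ((surj , _) , gi) →
           generalisedInverse⇒section (IsGeneralisedInverse-sym gi) (surjective-ker⊆𝟎 surj) })

  section⇔orthoIso-onto-im : IsOrthoclosedSection ⇔
    ((im {X = X} {Y = Y} f ≐ (Y ᗮ) (ker {X = Y} {Y = X} g))
     × IsOrthoIsoOn {X = X} {Y = Y} U (im {X = X} {Y = Y} f) f g)
  section⇔orthoIso-onto-im = mk⇔
    (λ { (im-closed , gf≡id) →
           ≐-trans im-closed (≐-sym ᗮker≐ᗮᗮim)
           , IsOrthoIsoOn-cong ((λ _ → tt) , λ {x} _ → gf≡id x) (≐-sym (im≐Fix gf≡id))
                               fixedPoints-orthoIso })
    (λ { (im≐ᗮker , iso) →
           ≐-trans im≐ᗮker ᗮker≐ᗮᗮim , λ x → IsOrthoIsoOn.inv-left iso x tt })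

  section⇒zeroKernelRestrictions : IsOrthoclosedSection →
      ((X ᗮ) (ker {X = X} {Y = Y} f) ≐ U)
      × ((Y ᗮ) ((Y ᗮ) (im {X = X} {Y = Y} f)) ≐ im {X = X} {Y = Y} f)
      × ((Y ᗮ) (ker {X = Y} {Y = X} g) ≐ im {X = X} {Y = Y} f)
      × ((X ᗮ) ((X ᗮ) (im {X = Y} {Y = X} g)) ≐ U)
  section⇒zeroKernelRestrictions s@(im-closed , gf≡id) =
    ᗮ-of-⊆𝟎 X (proj₁ (ker≐𝟎 gf≡id))
    , ≐-sym im-closed
    , ≐-sym (proj₁ (to section⇔orthoIso-onto-im s))
    , ᗮ-of-⊆𝟎 X (proj₁ (ᗮ-of-full X (λ x → f x , gf≡id x)))

proposition4p5 : {a b : Level} (X : Orthoset a) (Y : Orthoset b)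
    (f : Carrier X → Carrier Y) (g : Carrier Y → Carrier X) →
    IsAdjoint {X = X} {Y = Y} f g →
    ((IsOrthometry {X = X} {Y = Y} f × IsGeneralisedInverse {X = X} {Y = Y} f g)
      ⇔ (IsCoorthometry {X = Y} {Y = X} g × IsGeneralisedInverse {X = Y} {Y = X} g f))
    × ((IsOrthometry {X = X} {Y = Y} f × IsGeneralisedInverse {X = X} {Y = Y} f g)
      ⇔ ((im {X = X} {Y = Y} f ≐ (Y ᗮ) (ker {X = Y} {Y = X} g))
         × IsOrthoIsoOn {X = X} {Y = Y} U (im {X = X} {Y = Y} f) f g))
    × ((IsOrthometry {X = X} {Y = Y} f × IsGeneralisedInverse {X = X} {Y = Y} f g)
      ⇔ (Orthoclosed Y (im {X = X} {Y = Y} f) × (∀ x → g (f x) ≡ x)))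
    × ((IsOrthometry {X = X} {Y = Y} f × IsGeneralisedInverse {X = X} {Y = Y} f g) →
        ((X ᗮ) (ker {X = X} {Y = Y} f) ≐ U)
        × ((Y ᗮ) ((Y ᗮ) (im {X = X} {Y = Y} f)) ≐ im {X = X} {Y = Y} f)
        × ((Y ᗮ) (ker {X = Y} {Y = X} g) ≐ im {X = X} {Y = Y} f)
        × ((X ᗮ) ((X ᗮ) (im {X = Y} {Y = X} g)) ≐ U))
proposition4p5 X Y f g adj =
    mk⇔ (to section⇔coorthometry ∘ from section⇔orthometry)
        (to section⇔orthometry ∘ from section⇔coorthometry)
  , mk⇔ (to section⇔orthoIso-onto-im ∘ from section⇔orthometry)
        (to section⇔orthometry ∘ from section⇔orthoIso-onto-im)
  , mk⇔ (from section⇔orthometry) (to section⇔orthometry)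
  , section⇒zeroKernelRestrictions ∘ from section⇔orthometry
  where open OrthoclosedSection {X = X} {Y = Y} {f} {g} adj
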